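{- For every vertex $b\in B_0$: (i) the set of neighbors of $b$ in $V(G_0)\setminus\{u_0,u_1\}$ is contained in the union of two consecutive levels $L_j\cup L_{j+1}$ and forms a clique; (ii) if $b$ is adjacent to a vertex $v\in V(G_0)\setminus\{u_0,u_1\}$, then $b$ is either adjacent to all vertices of $N^-(v)$ or to none of them, and $b$ is adjacent to all vertices of $N^+(v)$ or to all vertices of $N^-(v)$.
   Context: Let $G$ be a graph with no induced claw ($K_{1,3}$) and no even hole (induced cycle of even length at least $4$). Fix two adjacent vertices $u_0,u_1$ of $G$, let $B_0=N_G(u_0)\setminus\{u_1\}$, and let $G_0$ be the connected component of $G-B_0$ containing $u_0$. For $j\ge 0$, $L_j=\{u\in V(G_0): d_{G_0}(u,u_0)=j\}$. For $v\in L_i$, $N^+(v)=N_G(v)\cap L_{i+1}$ and $N^-(v)=N_G(v)\cap L_{i-1}$. -}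

module Defs where

open import Data.Nat using (ℕ; zero; suc; _≤_)
open import Data.Nat.Divisibility using (_∣_)
open import Data.Fin using (Fin; toℕ)
open import Data.Product using (Σ; _×_; ∃; ∃-syntax)
open import Data.Sum using (_⊎_)
open import Relation.Nullary using (¬_; Dec)
open import Relation.Binary.PropositionalEquality using (_≡_; _≢_)
open import Function.Definitions using (Injective)
open import Function.Bundles using (_⇔_)

record Graph (n : ℕ) : Set₁ where
  field
    Adj     : Fin n → Fin n → Set
    adj?    : ∀ x y → Dec (Adj x y)
    adjSym  : ∀ {x y} → Adj x y → Adj y x
    adjIrr  : ∀ {x} → ¬ Adj x x

module _ {n : ℕ} (G : Graph n) where
  open Graph G

  ClawFree : Set
  ClawFree = ∀ c a₁ a₂ a₃ → Adj c a₁ → Adj c a₂ → Adj c a₃ →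
             a₁ ≢ a₂ → a₁ ≢ a₃ → a₂ ≢ a₃ →
             ¬ (¬ Adj a₁ a₂ × ¬ Adj a₁ a₃ × ¬ Adj a₂ a₃)

  CycAdj : (k : ℕ) → Fin k → Fin k → Set
  CycAdj k i j = suc (toℕ i) ≡ toℕ j ⊎ suc (toℕ j) ≡ toℕ i
               ⊎ (toℕ i ≡ 0 × suc (toℕ j) ≡ k) ⊎ (toℕ j ≡ 0 × suc (toℕ i) ≡ k)

  InducedCycle : ℕ → Set
  InducedCycle k = Σ (Fin k → Fin n) λ f → Injective _≡_ _≡_ f ×
                   (∀ i j → Adj (f i) (f j) ⇔ CycAdj k i j)

  EvenHoleFree : Set
  EvenHoleFree = ∀ k → 4 ≤ k → 2 ∣ k → ¬ InducedCycle k

  data WalkIn (P : Fin n → Set) : Fin n → Fin n → ℕ → Set where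
    here : ∀ {x} → P x → WalkIn P x x 0
    step : ∀ {x y z m} → P x → Adj x y → WalkIn P y z m → WalkIn P x z (suc m)

  module Setup (u₀ u₁ : Fin n) where
    InB₀ : Fin n → Set
    InB₀ v = Adj u₀ v × v ≢ u₁

    NotB₀ : Fin n → Set
    NotB₀ v = ¬ InB₀ v

    -- V(G₀): the component of G - B₀ containing u₀
    InG₀ : Fin n → Set
    InG₀ v = ∃[ m ] WalkIn NotB₀ u₀ v m

    Level : ℕ → Fin n → Set
    Level j v = WalkIn NotB₀ u₀ v j × (∀ m → WalkIn NotB₀ u₀ v m → j ≤ m)

    InN⁺ : Fin n → Fin n → Set
    InN⁺ v w = ∃[ i ] (Level i v × Level (suc i) w × Adj v w)

    InN⁻ : Fin n → Fin n → Set
    InN⁻ v w = ∃[ i ] (Level (suc i) v × Level i w × Adj v w)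

    InG₀' : Fin n → Set
    InG₀' v = InG₀ v × v ≢ u₀ × v ≢ u₁

{-# OPTIONS --safe #-}
module Submission where

-- Both parts come from two forbidden configurations. Since u₀ is adjacent to b but to no
-- vertex of G₀ other than u₁, any two neighbours v, w of b in G₀ - {u₀, u₁} are adjacent,
-- for otherwise b, u₀, v, w is a claw; as levels of adjacent vertices differ by at most one,
-- the neighbours of b lie on two consecutive levels. For (ii) let v ∈ L_{i+1} be adjacent
-- to b, let w₁, w₂ ∈ L_i be adjacent to v, and suppose b sees w₁ but not w₂. The vertex b
-- sees L_α (α = 1 if b ~ u₁, else α = 0), and no level strictly between α and i, since its
-- neighbours there would lie within one level of v. Closing a shortest path from L_α to w₁
-- with b, or one from L_α through w₂ to v with b, gives two holes whose lengths differ by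
-- one, so one of them is even. Finally, if b misses a parent p of v and a child x of v,
-- then v, b, p, x is a claw.

open import Defs
open import Data.Nat using (ℕ; zero; suc; _+_; _≤_; _<_; z≤n; s≤s; s≤s⁻¹; _≤?_)
open import Data.Nat.Properties
open import Data.Nat.Divisibility using (_∣_; divides; ∣-refl; ∣m∣n⇒∣m+n; ∣⇒≤)
open import Data.Fin using (Fin; toℕ) renaming (zero to fzero; suc to fsuc)
import Data.Fin.Properties as Fin
open import Data.Product using (_×_; ∃; ∃-syntax; _,_; proj₁; proj₂)
open import Data.Sum using (_⊎_; inj₁; inj₂; [_,_]′)
open import Data.Empty using (⊥-elim)
open import Function using (_∘_)
open import Function.Bundles using (_⇔_; mk⇔; Equivalence)
open import Function.Construct.Composition using (_⇔-∘_)
open import Function.Construct.Symmetry using (⇔-sym)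
open import Function.Definitions using (Injective)
open import Relation.Nullary using (¬_; Dec; yes; no)
open import Relation.Nullary.Decidable using (_×-dec_; ¬?; decidable-stable)
open import Relation.Binary.PropositionalEquality
  using (_≡_; _≢_; refl; sym; trans; cong; subst; subst₂)

open Equivalence using (to; from)

Least : (ℕ → Set) → ℕ → Set
Least Q k = Q k × (∀ m → Q m → k ≤ m)

least-unique : ∀ {Q i j} → Least Q i → Least Q j → i ≡ j
least-unique (qi , i-least) (qj , j-least) = ≤-antisym (i-least _ qj) (j-least _ qi)

least-or-none : ∀ {Q} → (∀ k → Dec (Q k)) → ∀ N → ∃ (Least Q) ⊎ (∀ k → k < N → ¬ Q k)
least-or-none Q? zero = inj₂ (λ _ ())
least-or-none {Q} Q? (suc N) with least-or-none Q? N | Q? N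
... | inj₁ least | _ = inj₁ least
... | inj₂ none | yes q = inj₁ (N , q , λ m qm → ≮⇒≥ (λ m<N → none m m<N qm))
... | inj₂ none | no ¬q =
  inj₂ λ k k<1+N → [ none k , (λ k≡N → ¬q ∘ subst Q k≡N) ]′ (m≤n⇒m<n∨m≡n (s≤s⁻¹ k<1+N))

least-exists : ∀ {Q m} → (∀ k → Dec (Q k)) → Q m → ∃ (Least Q)
least-exists {m = m} Q? q with least-or-none Q? (suc m)
... | inj₁ least = least
... | inj₂ none = ⊥-elim (none m ≤-refl q)

even-or-odd : ∀ d → 2 ∣ d ⊎ 2 ∣ suc d
even-or-odd zero = inj₁ (divides 0 refl)
even-or-odd (suc d) with even-or-odd d
... | inj₁ (divides q eq) = inj₂ (divides (suc q) (cong (suc ∘ suc) eq))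
... | inj₂ 2∣1+d = inj₁ 2∣1+d

between-suc : ∀ {j k} → j ≤ k → k ≤ suc j → k ≡ j ⊎ k ≡ suc j
between-suc j≤k k≤1+j with m≤n⇒m<n∨m≡n k≤1+j
... | inj₁ k<1+j = inj₁ (≤-antisym (s≤s⁻¹ k<1+j) j≤k)
... | inj₂ k≡1+j = inj₂ k≡1+j

near-distinct⇒consecutive : ∀ {a b} → a ≤ suc b → b ≤ suc a → a ≢ b → suc a ≡ b ⊎ suc b ≡ a
near-distinct⇒consecutive {a} {b} a≤1+b b≤1+a a≢b with ≤-total a b
... | inj₁ a≤b = [ ⊥-elim ∘ a≢b ∘ sym , inj₁ ∘ sym ]′ (between-suc a≤b b≤1+a)
... | inj₂ b≤a = [ ⊥-elim ∘ a≢b , inj₂ ∘ sym ]′ (between-suc b≤a a≤1+b)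

module InducedCycles {n : ℕ} (G : Graph n) where
  open Graph G

  PathAdj : ∀ {k} → Fin k → Fin k → Set
  PathAdj s t = suc (toℕ s) ≡ toℕ t ⊎ suc (toℕ t) ≡ toℕ s

  IsInducedPath : ∀ {k} → (Fin k → Fin n) → Set
  IsInducedPath f = Injective _≡_ _≡_ f × (∀ s t → Adj (f s) (f t) ⇔ PathAdj s t)

  cycAdj-sym : ∀ {k} i j → CycAdj G k i j → CycAdj G k j i
  cycAdj-sym i j (inj₁ e) = inj₂ (inj₁ e)
  cycAdj-sym i j (inj₂ (inj₁ e)) = inj₁ e
  cycAdj-sym i j (inj₂ (inj₂ (inj₁ e))) = inj₂ (inj₂ (inj₂ e))
  cycAdj-sym i j (inj₂ (inj₂ (inj₂ e))) = inj₂ (inj₂ (inj₁ e))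

  ¬cycAdj-zero-zero : ∀ {d} → ¬ CycAdj G (suc (suc d)) fzero fzero
  ¬cycAdj-zero-zero (inj₁ ())
  ¬cycAdj-zero-zero (inj₂ (inj₁ ()))
  ¬cycAdj-zero-zero (inj₂ (inj₂ (inj₁ (_ , ()))))
  ¬cycAdj-zero-zero (inj₂ (inj₂ (inj₂ (_ , ()))))

  cycAdj-zero-suc : ∀ {d} (t : Fin (suc d)) →
                    CycAdj G (suc (suc d)) fzero (fsuc t) ⇔ (toℕ t ≡ 0 ⊎ toℕ t ≡ d)
  cycAdj-zero-suc t = mk⇔ to′ from′
    where
    to′ : CycAdj G _ fzero (fsuc t) → toℕ t ≡ 0 ⊎ toℕ t ≡ _
    to′ (inj₁ e) = inj₁ (sym (suc-injective e))
    to′ (inj₂ (inj₁ ()))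
    to′ (inj₂ (inj₂ (inj₁ (_ , e)))) = inj₂ (suc-injective (suc-injective e))
    to′ (inj₂ (inj₂ (inj₂ (() , _))))
    from′ : toℕ t ≡ 0 ⊎ toℕ t ≡ _ → CycAdj G _ fzero (fsuc t)
    from′ (inj₁ e) = inj₁ (cong suc (sym e))
    from′ (inj₂ e) = inj₂ (inj₂ (inj₁ (refl , cong (suc ∘ suc) e)))

  cycAdj-suc-suc : ∀ {d} (s t : Fin (suc d)) →
                   CycAdj G (suc (suc d)) (fsuc s) (fsuc t) ⇔ PathAdj s t
  cycAdj-suc-suc s t = mk⇔ to′ from′
    where
    to′ : CycAdj G _ (fsuc s) (fsuc t) → PathAdj s t
    to′ (inj₁ e) = inj₁ (suc-injective e)
    to′ (inj₂ (inj₁ e)) = inj₂ (suc-injective e)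
    to′ (inj₂ (inj₂ (inj₁ (() , _))))
    to′ (inj₂ (inj₂ (inj₂ (() , _))))
    from′ : PathAdj s t → CycAdj G _ (fsuc s) (fsuc t)
    from′ (inj₁ e) = inj₁ (cong suc e)
    from′ (inj₂ e) = inj₂ (inj₁ (cong suc e))

  apex-cycle : ∀ {d} {f : Fin (suc d) → Fin n} → IsInducedPath f → ∀ x →
               (∀ t → x ≢ f t) → (∀ t → Adj x (f t) ⇔ (toℕ t ≡ 0 ⊎ toℕ t ≡ d)) →
               InducedCycle G (suc (suc d))
  apex-cycle {d} {f} (f-inj , f-adj) x x∉f x-adj = g , g-inj , g-adj
    where
    g : Fin (suc (suc d)) → Fin n
    g fzero = x
    g (fsuc t) = f t
    g-inj : Injective _≡_ _≡_ g
    g-inj {fzero} {fzero} _ = refl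
    g-inj {fzero} {fsuc t} e = ⊥-elim (x∉f t e)
    g-inj {fsuc s} {fzero} e = ⊥-elim (x∉f s (sym e))
    g-inj {fsuc s} {fsuc t} e = cong fsuc (f-inj e)
    g-adj : ∀ i j → Adj (g i) (g j) ⇔ CycAdj G (suc (suc d)) i j
    g-adj fzero fzero = mk⇔ (⊥-elim ∘ adjIrr) (⊥-elim ∘ ¬cycAdj-zero-zero)
    g-adj fzero (fsuc t) = ⇔-sym (cycAdj-zero-suc t) ⇔-∘ x-adj t
    g-adj (fsuc s) fzero =
      mk⇔ (cycAdj-sym fzero (fsuc s) ∘ to (g-adj fzero (fsuc s)) ∘ adjSym)
          (adjSym ∘ from (g-adj fzero (fsuc s)) ∘ cycAdj-sym (fsuc s) fzero)
    g-adj (fsuc s) (fsuc t) = ⇔-sym (cycAdj-suc-suc s t) ⇔-∘ f-adj s t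

module Walks {n : ℕ} (G : Graph n) (P : Fin n → Set) where
  open Graph G

  Walk : Fin n → Fin n → ℕ → Set
  Walk = WalkIn G P

  walk-last : ∀ {x z m} → Walk x z m → P z
  walk-last (here pz) = pz
  walk-last (step _ _ w) = walk-last w

  walk-zero : ∀ {x z} → Walk x z 0 → x ≡ z
  walk-zero (here _) = refl

  snoc : ∀ {x y z m} → Walk x y m → Adj y z → P z → Walk x z (suc m)
  snoc (here px) x~z pz = step px x~z (here pz)
  snoc (step px x~y w) y~z pz = step px x~y (snoc w y~z pz)

  unsnoc : ∀ {x z m} → Walk x z (suc m) → ∃[ y ] (Walk x y m × Adj y z)
  unsnoc (step px x~z (here _)) = _ , here px , x~z
  unsnoc (step px x~y w@(step _ _ _)) with unsnoc w
  ... | y , w′ , y~z = y , step px x~y w′ , y~z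

  module _ (P? : ∀ v → Dec (P v)) where

    walk? : ∀ m x z → Dec (Walk x z m)
    walk? zero x z with x Fin.≟ z | P? x
    ... | yes refl | yes px = yes (here px)
    ... | yes refl | no ¬px = no λ { (here px) → ¬px px }
    ... | no x≢z | _ = no (x≢z ∘ walk-zero)
    walk? (suc m) x z with P? x | Fin.any? (λ y → adj? x y ×-dec walk? m y z)
    ... | yes px | yes (y , x~y , w) = yes (step px x~y w)
    ... | no ¬px | _ = no λ { (step px _ _) → ¬px px }
    ... | yes _ | no ¬w = no λ { (step _ x~y w) → ¬w (_ , x~y , w) }

module Distances {n : ℕ} (G : Graph n) (P : Fin n → Set) (r : Fin n) where
  open Graph G
  open InducedCycles G
  open Walks G P

  Dist : ℕ → Fin n → Set
  Dist k v = Least (Walk r v) k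

  dist-unique : ∀ {i j v} → Dist i v → Dist j v → i ≡ j
  dist-unique = least-unique

  dist-in-P : ∀ {k v} → Dist k v → P v
  dist-in-P = walk-last ∘ proj₁

  dist-zero : ∀ {v} → Dist 0 v → v ≡ r
  dist-zero = sym ∘ walk-zero ∘ proj₁

  dist-adj : ∀ {i j x y} → Dist i x → Dist j y → Adj x y → j ≤ suc i
  dist-adj (wx , _) (wy , y-least) x~y = y-least _ (snoc wx x~y (walk-last wy))

  dist-pred : ∀ {i w} → Dist (suc i) w → ∃[ p ] (Dist i p × Adj p w)
  dist-pred (w , w-least) with unsnoc w
  ... | p , wp , p~w = p , (wp , λ m wm → s≤s⁻¹ (w-least _ (snoc wm p~w (walk-last w)))) , p~w

  dist-exists : (∀ v → Dec (P v)) → ∀ {m v} → Walk r v m → ∃[ k ] Dist k v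
  dist-exists P? {v = v} = least-exists (λ k → walk? P? k r v)

  record Geodesic (top : ℕ) (w : Fin n) : Set where
    field
      vertex     : ℕ → Fin n
      dist       : ∀ {k} → k ≤ top → Dist k (vertex k)
      adjacent   : ∀ {k} → k < top → Adj (vertex k) (vertex (suc k))
      vertex-top : vertex top ≡ w

  open Geodesic

  module _ {i p} (g : Geodesic i p) (w : Fin n) where

    extend-vertex : ℕ → Fin n
    extend-vertex k with k ≤? i
    ... | yes _ = vertex g k
    ... | no _ = w

    extend-vertex-≤ : ∀ {k} → k ≤ i → extend-vertex k ≡ vertex g k
    extend-vertex-≤ {k} k≤i with k ≤? i
    ... | yes _ = refl
    ... | no k≰i = ⊥-elim (k≰i k≤i)

    extend-vertex-top : extend-vertex (suc i) ≡ w
    extend-vertex-top with suc i ≤? i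
    ... | yes 1+i≤i = ⊥-elim (1+n≰n 1+i≤i)
    ... | no _ = refl

  extend : ∀ {i p w} (g : Geodesic i p) → Dist (suc i) w → Adj p w → Geodesic (suc i) w
  extend {w = w} g dw p~w .vertex = extend-vertex g w
  extend {i} {w = w} g dw p~w .dist {k} k≤1+i with m≤n⇒m<n∨m≡n k≤1+i
  ... | inj₁ k<1+i = subst (Dist k) (sym (extend-vertex-≤ g w (s≤s⁻¹ k<1+i))) (dist g (s≤s⁻¹ k<1+i))
  ... | inj₂ refl = subst (Dist (suc i)) (sym (extend-vertex-top g w)) dw
  extend {w = w} g dw p~w .adjacent {k} k<1+i with m≤n⇒m<n∨m≡n (s≤s⁻¹ k<1+i)
  ... | inj₁ k<i = subst₂ Adj (sym (extend-vertex-≤ g w (<⇒≤ k<i))) (sym (extend-vertex-≤ g w k<i))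
                     (adjacent g k<i)
  ... | inj₂ refl = subst₂ Adj (sym (trans (extend-vertex-≤ g w ≤-refl) (vertex-top g)))
                      (sym (extend-vertex-top g w)) p~w
  extend {w = w} g dw p~w .vertex-top = extend-vertex-top g w

  geodesic : ∀ {i w} → Dist i w → Geodesic i w
  geodesic {zero} {w} dw = record
    { vertex = λ _ → w ; dist = λ { z≤n → dw } ; adjacent = λ () ; vertex-top = refl }
  geodesic {suc i} dw with dist-pred dw
  ... | p , dp , p~w = extend (geodesic dp) dw p~w

  dist<n : ∀ {k v} → Dist k v → k < n
  dist<n {k} {v} dv = Fin.injective⇒≤ vertex-injective
    where
    g : Geodesic k v
    g = geodesic dv
    toℕ≤k : (t : Fin (suc k)) → toℕ t ≤ k
    toℕ≤k = Fin.toℕ≤pred[n]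
    vertex-injective : Injective _≡_ _≡_ (λ (t : Fin (suc k)) → vertex g (toℕ t))
    vertex-injective {s} {t} e = Fin.toℕ-injective
      (dist-unique (dist g (toℕ≤k s)) (subst (Dist (toℕ t)) (sym e) (dist g (toℕ≤k t))))

  segment-induced : ∀ {top w} (g : Geodesic top w) α d → α + d ≤ top →
                    IsInducedPath (λ (t : Fin (suc d)) → vertex g (α + toℕ t))
  segment-induced {top} g α d α+d≤top = seg-inj , λ s t → mk⇔ (seg-adj s t) (seg-consecutive s t)
    where
    α+t≤top : (t : Fin (suc d)) → α + toℕ t ≤ top
    α+t≤top t = ≤-trans (+-monoʳ-≤ α (Fin.toℕ≤pred[n] t)) α+d≤top
    dist-at : (t : Fin (suc d)) → Dist (α + toℕ t) (vertex g (α + toℕ t))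
    dist-at t = dist g (α+t≤top t)
    seg-inj : Injective _≡_ _≡_ (λ (t : Fin (suc d)) → vertex g (α + toℕ t))
    seg-inj {s} {t} e = Fin.toℕ-injective (+-cancelˡ-≡ α _ _
      (dist-unique (dist-at s) (subst (Dist (α + toℕ t)) (sym e) (dist-at t))))
    seg-adj : ∀ s t → Adj (vertex g (α + toℕ s)) (vertex g (α + toℕ t)) → PathAdj s t
    seg-adj s t s~t
      with near-distinct⇒consecutive (dist-adj (dist-at t) (dist-at s) (adjSym s~t))
                                      (dist-adj (dist-at s) (dist-at t) s~t) distinct
      where
      distinct : α + toℕ s ≢ α + toℕ t
      distinct e = adjIrr (subst (λ k → Adj (vertex g (α + toℕ s)) (vertex g k)) (sym e) s~t)
    ... | inj₁ e = inj₁ (+-cancelˡ-≡ α _ _ (trans (+-suc α (toℕ s)) e))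
    ... | inj₂ e = inj₂ (+-cancelˡ-≡ α _ _ (trans (+-suc α (toℕ t)) e))
    step-at : ∀ s t → suc (toℕ s) ≡ toℕ t → Adj (vertex g (α + toℕ s)) (vertex g (α + toℕ t))
    step-at s t e = subst (λ k → Adj (vertex g (α + toℕ s)) (vertex g k)) α+s+1≡α+t
      (adjacent g (subst (_≤ top) (sym α+s+1≡α+t) (α+t≤top t)))
      where
      α+s+1≡α+t : suc (α + toℕ s) ≡ α + toℕ t
      α+s+1≡α+t = trans (sym (+-suc α (toℕ s))) (cong (α +_) e)
    seg-consecutive : ∀ s t → PathAdj s t → Adj (vertex g (α + toℕ s)) (vertex g (α + toℕ t))
    seg-consecutive s t (inj₁ e) = step-at s t e
    seg-consecutive s t (inj₂ e) = adjSym (step-at t s e)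

  geodesic-apex-cycle : ∀ {top w x} (g : Geodesic top w) α d → α + d ≡ top → ¬ P x →
    Adj x (vertex g α) → Adj x w → (∀ {k} → α < k → k < top → ¬ Adj x (vertex g k)) →
    InducedCycle G (suc (suc d))
  geodesic-apex-cycle {top} {w} {x} g α d α+d≡top ¬px x~first x~last x≁inner =
    apex-cycle (segment-induced g α d (≤-reflexive α+d≡top)) x x∉segment
      λ t → mk⇔ (endpoint t) (endpoint-adj t)
    where
    x∉segment : ∀ t → x ≢ vertex g (α + toℕ t)
    x∉segment t e = ¬px (subst P (sym e)
      (dist-in-P (dist g (subst (α + toℕ t ≤_) α+d≡top (+-monoʳ-≤ α (Fin.toℕ≤pred[n] t))))))
    endpoint : ∀ t → Adj x (vertex g (α + toℕ t)) → toℕ t ≡ 0 ⊎ toℕ t ≡ d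
    endpoint t x~t with toℕ t ≟ 0 | toℕ t ≟ d
    ... | yes t≡0 | _ = inj₁ t≡0
    ... | no _ | yes t≡d = inj₂ t≡d
    ... | no t≢0 | no t≢d = ⊥-elim (x≁inner (m<m+n α (n≢0⇒n>0 t≢0))
          (subst (α + toℕ t <_) α+d≡top (+-monoʳ-< α (≤∧≢⇒< (Fin.toℕ≤pred[n] t) t≢d))) x~t)
    endpoint-adj : ∀ t → toℕ t ≡ 0 ⊎ toℕ t ≡ d → Adj x (vertex g (α + toℕ t))
    endpoint-adj t (inj₁ t≡0) =
      subst (Adj x ∘ vertex g) (sym (trans (cong (α +_) t≡0) (+-identityʳ α))) x~first
    endpoint-adj t (inj₂ t≡d) =
      subst (Adj x) (sym (trans (cong (vertex g) (trans (cong (α +_) t≡d) α+d≡top)) (vertex-top g)))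
        x~last

module LevelStructure {n : ℕ} (G : Graph n) (claw-free : ClawFree G)
                      (even-hole-free : EvenHoleFree G)
                      (u₀ u₁ : Fin n) (u₀~u₁ : Graph.Adj G u₀ u₁) where
  open Graph G
  open Setup G u₀ u₁
  open Walks G NotB₀
  -- Level (from Setup) is definitionally Dist for walks avoiding B₀ from u₀.
  open Distances G NotB₀ u₀
  open Geodesic

  NotB₀? : ∀ v → Dec (NotB₀ v)
  NotB₀? v = ¬? (adj? u₀ v ×-dec ¬? (v Fin.≟ u₁))

  u₀∉B₀ : NotB₀ u₀
  u₀∉B₀ (u₀~u₀ , _) = adjIrr u₀~u₀

  u₁∉B₀ : NotB₀ u₁
  u₁∉B₀ (_ , u₁≢u₁) = u₁≢u₁ refl

  u₀-level : Level 0 u₀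
  u₀-level = here u₀∉B₀ , λ _ _ → z≤n

  u₁-level : Level 1 u₁
  u₁-level = step u₀∉B₀ u₀~u₁ (here u₁∉B₀) , u₁-far
    where
    u₁-far : ∀ m → Walk u₀ u₁ m → 1 ≤ m
    u₁-far zero w = ⊥-elim (adjIrr (subst (λ x → Adj x u₁) (walk-zero w) u₀~u₁))
    u₁-far (suc m) _ = s≤s z≤n

  level-zero : ∀ {v} → Level 0 v → v ≡ u₀
  level-zero = dist-zero

  level-one : ∀ {v} → Level 1 v → v ≡ u₁
  level-one {v} (step _ u₀~v (here v∉B₀) , _) with v Fin.≟ u₁
  ... | yes v≡u₁ = v≡u₁
  ... | no v≢u₁ = ⊥-elim (v∉B₀ (u₀~v , v≢u₁))

  Inner : Fin n → Set
  Inner v = NotB₀ v × v ≢ u₀ × v ≢ u₁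

  InG₀'-inner : ∀ {v} → InG₀' v → Inner v
  InG₀'-inner ((_ , w) , v≢u₀ , v≢u₁) = walk-last w , v≢u₀ , v≢u₁

  InG₀'-level : ∀ {v} → InG₀' v → ∃[ k ] Level k v
  InG₀'-level ((_ , w) , _) = dist-exists NotB₀? w

  level≥2-inner : ∀ {k v} → 2 ≤ k → Level k v → Inner v
  level≥2-inner 2≤k lv =
    dist-in-P lv ,
    (λ v≡u₀ → <⇒≢ (<⇒≤ 2≤k) (sym (dist-unique lv (subst (Level 0) (sym v≡u₀) u₀-level)))) ,
    (λ v≡u₁ → <⇒≢ 2≤k (sym (dist-unique lv (subst (Level 1) (sym v≡u₁) u₁-level))))

  B₀-neighbours-adjacent : ∀ {b v w} → InB₀ b → Inner v → Inner w →
                           Adj b v → Adj b w → v ≢ w → Adj v w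
  B₀-neighbours-adjacent {b} {v} {w} (u₀~b , _) (v∉B₀ , v≢u₀ , v≢u₁) (w∉B₀ , w≢u₀ , w≢u₁)
                         b~v b~w v≢w with adj? v w
  ... | yes v~w = v~w
  ... | no v≁w = ⊥-elim (claw-free b u₀ v w (adjSym u₀~b) b~v b~w (v≢u₀ ∘ sym) (w≢u₀ ∘ sym) v≢w
                   ((λ u₀~v → v∉B₀ (u₀~v , v≢u₁)) , (λ u₀~w → w∉B₀ (u₀~w , w≢u₁)) , v≁w))

  B₀-neighbour-levels-close : ∀ {b v w i j} → InB₀ b → Inner v → Inner w →
                              Adj b v → Adj b w → Level i v → Level j w → j ≤ suc i
  B₀-neighbour-levels-close {v = v} {w} b∈B₀ v-inner w-inner b~v b~w lv lw with v Fin.≟ w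
  ... | yes refl = m≤n⇒m≤1+n (≤-reflexive (dist-unique lw lv))
  ... | no v≢w = dist-adj lv lw (B₀-neighbours-adjacent b∈B₀ v-inner w-inner b~v b~w v≢w)

  B₀-neighbours-two-levels : ∀ {b} → InB₀ b →
    ∃[ j ] (∀ v → InG₀' v → Adj b v → Level j v ⊎ Level (suc j) v)
  B₀-neighbours-two-levels {b} b∈B₀ with least-or-none NeighbourAt? n
    where
    NeighbourAt : ℕ → Set
    NeighbourAt k = ∃[ v ] (Adj b v × (v ≢ u₀ × v ≢ u₁) × Walk u₀ v k)
    NeighbourAt? : ∀ k → Dec (NeighbourAt k)
    NeighbourAt? k = Fin.any? λ v →
      adj? b v ×-dec (¬? (v Fin.≟ u₀) ×-dec ¬? (v Fin.≟ u₁)) ×-dec walk? NotB₀? k u₀ v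
  ... | inj₂ none = 0 , λ v v∈G₀' b~v →
    let k , lv = InG₀'-level v∈G₀' in ⊥-elim (none k (dist<n lv) (v , b~v , proj₂ v∈G₀' , proj₁ lv))
  ... | inj₁ (j , (v₀ , b~v₀ , v₀≢ , w₀) , j-least) = j , two-levels
    where
    lv₀ : Level j v₀
    lv₀ = w₀ , λ m w → j-least m (v₀ , b~v₀ , v₀≢ , w)
    two-levels : ∀ v → InG₀' v → Adj b v → Level j v ⊎ Level (suc j) v
    two-levels v v∈G₀' b~v with InG₀'-level v∈G₀'
    ... | k , lv = [ inj₁ ∘ level-is , inj₂ ∘ level-is ]′ (between-suc j≤k k≤1+j)
      where
      j≤k : j ≤ k
      j≤k = j-least k (v , b~v , proj₂ v∈G₀' , proj₁ lv)
      k≤1+j : k ≤ suc j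
      k≤1+j = B₀-neighbour-levels-close b∈B₀ (walk-last w₀ , v₀≢) (InG₀'-inner v∈G₀')
                b~v₀ b~v lv₀ lv
      level-is : ∀ {l} → k ≡ l → Level l v
      level-is k≡l = subst (λ l → Level l v) k≡l lv

  far-levels-unseen : ∀ {b v y i k} → InB₀ b → Inner v → Adj b v → Level (suc i) v →
                      Level k y → 2 ≤ k → k < i → ¬ Adj b y
  far-levels-unseen b∈B₀ v-inner b~v lv ly 2≤k k<i b~y =
    <⇒≱ k<i (s≤s⁻¹ (B₀-neighbour-levels-close b∈B₀ (level≥2-inner 2≤k ly) v-inner b~y b~v ly lv))

  EvenHole : Set
  EvenHole = ∃[ k ] (4 ≤ k × 2 ∣ k × InducedCycle G k)

  -- b closes the geodesic to w₁ into a hole of length d + 3 and the geodesic through w₂ to v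
  -- into one of length d + 4.
  gap-even-hole : ∀ {b v w₁ w₂} α d → InB₀ b →
    (∀ {y} → Level α y → Adj b y) →
    (∀ {k y} → Level k y → α < k → k < α + suc d → ¬ Adj b y) →
    Level (α + suc d) w₁ → Level (α + suc d) w₂ → Level (suc (α + suc d)) v →
    Adj b w₁ → ¬ Adj b w₂ → Adj b v → Adj w₂ v → EvenHole
  gap-even-hole {b} {v} {w₁} {w₂} α d b∈B₀ sees-α misses-gap lw₁ lw₂ lv b~w₁ b≁w₂ b~v w₂~v
    with even-or-odd (suc d)
  ... | inj₁ 2∣1+d =
    _ , s≤s (s≤s (∣⇒≤ 2∣1+d)) , ∣m∣n⇒∣m+n ∣-refl 2∣1+d ,
    geodesic-apex-cycle g α (suc d) refl (λ b∉B₀ → b∉B₀ b∈B₀)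
      (sees-α (dist g (m≤m+n α (suc d)))) b~w₁
      (λ α<k k<top → misses-gap (dist g (<⇒≤ k<top)) α<k k<top)
    where
    g : Geodesic (α + suc d) w₁
    g = geodesic lw₁
  ... | inj₂ 2∣2+d =
    _ , s≤s (s≤s (s≤s (s≤s z≤n))) , ∣m∣n⇒∣m+n ∣-refl 2∣2+d ,
    geodesic-apex-cycle g α (suc (suc d)) (+-suc α (suc d)) (λ b∉B₀ → b∉B₀ b∈B₀)
      (sees-α (dist g (m≤n⇒m≤1+n (m≤m+n α (suc d))))) b~v misses
    where
    g₂ : Geodesic (α + suc d) w₂
    g₂ = geodesic lw₂
    g : Geodesic (suc (α + suc d)) v
    g = extend g₂ lv w₂~v
    misses : ∀ {k} → α < k → k < suc (α + suc d) → ¬ Adj b (vertex g k)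
    misses α<k k<top with m≤n⇒m<n∨m≡n (s≤s⁻¹ k<top)
    ... | inj₁ k<i = misses-gap (dist g (<⇒≤ k<top)) α<k k<i
    ... | inj₂ refl = b≁w₂ ∘ subst (Adj b) (trans (extend-vertex-≤ g₂ v ≤-refl) (vertex-top g₂))

  no-even-hole : ¬ EvenHole
  no-even-hole (k , 4≤k , 2∣k , hole) = even-hole-free k 4≤k 2∣k hole

  ¬¬B₀-sees-other-parents : ∀ {b v w₁ w₂ i} → InB₀ b → Inner v → Level (suc i) v → Adj b v →
                            Level i w₁ → Level i w₂ → Adj w₂ v → Adj b w₁ → ¬ ¬ Adj b w₂
  ¬¬B₀-sees-other-parents {i = zero} _ (_ , _ , v≢u₁) lv _ _ _ _ _ _ = v≢u₁ (level-one lv)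
  ¬¬B₀-sees-other-parents {b} {i = suc zero} _ _ _ _ lw₁ lw₂ _ b~w₁ b≁w₂ =
    b≁w₂ (subst (Adj b) (trans (level-one lw₁) (sym (level-one lw₂))) b~w₁)
  ¬¬B₀-sees-other-parents {b} {i = suc (suc i)} b∈B₀ v-inner lv b~v lw₁ lw₂ w₂~v b~w₁ b≁w₂
    with adj? b u₁
  ... | yes b~u₁ = no-even-hole (gap-even-hole 1 i b∈B₀
        (λ ly → subst (Adj b) (sym (level-one ly)) b~u₁)
        (λ ly 1<k k<i → far-levels-unseen b∈B₀ v-inner b~v lv ly 1<k k<i)
        lw₁ lw₂ lv b~w₁ b≁w₂ b~v w₂~v)
  ... | no b≁u₁ = no-even-hole (gap-even-hole 0 (suc i) b∈B₀
        (λ ly → subst (Adj b) (sym (level-zero ly)) (adjSym (proj₁ b∈B₀)))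
        misses-gap lw₁ lw₂ lv b~w₁ b≁w₂ b~v w₂~v)
    where
    misses-gap : ∀ {k y} → Level k y → 0 < k → k < suc (suc i) → ¬ Adj b y
    misses-gap {suc zero} ly _ _ = b≁u₁ ∘ subst (Adj b) (level-one ly)
    misses-gap {suc (suc k)} ly _ k<i = far-levels-unseen b∈B₀ v-inner b~v lv ly (s≤s (s≤s z≤n)) k<i

  B₀-sees-other-parents : ∀ {b v w₁ w₂ i} → InB₀ b → Inner v → Level (suc i) v → Adj b v →
                          Level i w₁ → Level i w₂ → Adj w₂ v → Adj b w₁ → Adj b w₂
  B₀-sees-other-parents {b} {w₂ = w₂} b∈B₀ v-inner lv b~v lw₁ lw₂ w₂~v b~w₁ =
    decidable-stable (adj? b w₂) (¬¬B₀-sees-other-parents b∈B₀ v-inner lv b~v lw₁ lw₂ w₂~v b~w₁)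

  B₀-sees-children : ∀ {b v p x i} → InB₀ b → Adj b v → Level i p → Level (suc (suc i)) x →
                     Adj p v → Adj v x → ¬ Adj b p → Adj b x
  B₀-sees-children {b} {v} {p} {x} {i} b∈B₀ b~v lp lx p~v v~x b≁p with adj? b x
  ... | yes b~x = b~x
  ... | no b≁x = ⊥-elim (claw-free v b p x (adjSym b~v) (adjSym p~v) v~x b≢p b≢x p≢x
                   (b≁p , b≁x , p≁x))
    where
    b≢p : b ≢ p
    b≢p b≡p = dist-in-P lp (subst InB₀ b≡p b∈B₀)
    b≢x : b ≢ x
    b≢x b≡x = dist-in-P lx (subst InB₀ b≡x b∈B₀)
    p≢x : p ≢ x
    p≢x p≡x = <⇒≢ (m<n⇒m<1+n (n<1+n i))
                (dist-unique lp (subst (Level (suc (suc i))) (sym p≡x) lx))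
    p≁x : ¬ Adj p x
    p≁x p~x = 1+n≰n (dist-adj lp lx p~x)

  parent-level : ∀ {i j v w} → Level (suc j) v → Level (suc i) v → Level j w → Level i w
  parent-level {w = w} lv′ lv = subst (λ k → Level k w) (suc-injective (dist-unique lv′ lv))

  B₀-parents-and-children : ∀ {b v} → InB₀ b → InG₀' v → Adj b v →
    ((∀ w → InN⁻ v w → Adj b w) ⊎ (∀ w → InN⁻ v w → ¬ Adj b w))
    × ((∀ w → InN⁺ v w → Adj b w) ⊎ (∀ w → InN⁻ v w → Adj b w))
  B₀-parents-and-children {b} {v} b∈B₀ v∈G₀' b~v with InG₀'-level v∈G₀'
  ... | zero , lv = ⊥-elim (proj₁ (proj₂ v∈G₀') (level-zero lv))
  ... | suc i , lv with dist-pred lv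
  ... | p , lp , p~v with adj? b p
  ... | yes b~p = inj₁ sees-parents , inj₂ sees-parents
    where
    sees-parents : ∀ w → InN⁻ v w → Adj b w
    sees-parents w (_ , lv′ , lw , v~w) =
      B₀-sees-other-parents b∈B₀ (InG₀'-inner v∈G₀') lv b~v lp (parent-level lv′ lv lw) (adjSym v~w) b~p
  ... | no b≁p = inj₂ misses-parents , inj₁ sees-children
    where
    misses-parents : ∀ w → InN⁻ v w → ¬ Adj b w
    misses-parents w (_ , lv′ , lw , v~w) b~w =
      b≁p (B₀-sees-other-parents b∈B₀ (InG₀'-inner v∈G₀') lv b~v (parent-level lv′ lv lw) lp p~v b~w)
    sees-children : ∀ x → InN⁺ v x → Adj b x
    sees-children x (_ , lv′ , lx , v~x) =
      B₀-sees-children b∈B₀ b~v lp (subst (λ k → Level (suc k) x) (dist-unique lv′ lv) lx)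
        p~v v~x b≁p

lemma5p1 : ∀ {n} (G : Graph n) → ClawFree G → EvenHoleFree G →
    (u₀ u₁ : Fin n) → Graph.Adj G u₀ u₁ →
    let open Graph G
        open Setup G u₀ u₁
    in ∀ b → InB₀ b →
       ((∃[ j ] (∀ v → InG₀' v → Adj b v → Level j v ⊎ Level (suc j) v))
        × (∀ v w → InG₀' v → InG₀' w → Adj b v → Adj b w → v ≢ w → Adj v w))
       × (∀ v → InG₀' v → Adj b v →
          ((∀ w → InN⁻ v w → Adj b w) ⊎ (∀ w → InN⁻ v w → ¬ Adj b w))
          × ((∀ w → InN⁺ v w → Adj b w) ⊎ (∀ w → InN⁻ v w → Adj b w)))
lemma5p1 G claw-free even-hole-free u₀ u₁ u₀~u₁ b b∈B₀ =
  ( B₀-neighbours-two-levels b∈B₀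
  , λ v w v∈G₀' w∈G₀' → B₀-neighbours-adjacent b∈B₀ (InG₀'-inner v∈G₀') (InG₀'-inner w∈G₀'))
  , λ v v∈G₀' b~v → B₀-parents-and-children b∈B₀ v∈G₀' b~v
  where open LevelStructure G claw-free even-hole-free u₀ u₁ u₀~u₁
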